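{- Let $r$ be a positive integer and let $G$ be an $r$-BG graph with at least $r+1$ vertices, and let $A_0$ be a percolating set of $G$ (with threshold $r$) with $|A_0|=r$. Let $X\subseteq V(G)$ be a cut set of $G$ with $|X|<r$, and let $K$ be the set of components of $G-X$ whose vertex sets are not contained in $A_0$. Then $|V(C)\cap A_0|\ge r-|X|$ for each $C\in K$. Moreover, $|K|\le \lfloor r/(r-|X|)\rfloor$, and if $|K|\ge 2$ then $r/2\le |X|\le r-1$.
   Context: Bootstrap percolation with threshold $r$ on a finite simple graph $G$: starting from an initially infected set $A_0\subseteq V(G)$, define $A_t=A_{t-1}\cup\{v\in V(G): |N(v)\cap A_{t-1}|\ge r\}$ for $t\ge1$; $A_0$ percolates if eventually every vertex is infected. $G$ is $r$-bootstrap good ($r$-BG) if it contains a set of $r$ vertices which percolates with threshold $r$. A cut set of $G$ is a set $X\subseteq V(G)$ such that $G-X$ is disconnected. -}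

module Defs where

open import Data.Bool using (Bool; true; false)
open import Data.Nat using (ℕ; zero; suc; _≤ᵇ_; _≤_; _<_; _∸_; NonZero; >-nonZero; _/_)
open import Data.Nat.Properties using (m<n⇒0<n∸m)
open import Data.Fin using (Fin)
open import Data.Fin.Subset using (Subset; _∈_; _∉_; _∩_; _∪_; ∣_∣; ⊤)
open import Data.Vec using (tabulate)
open import Data.Product using (Σ; ∃; ∃-syntax; _×_)
open import Relation.Nullary using (¬_)
open import Relation.Binary.PropositionalEquality using (_≡_)

record Graph (n : ℕ) : Set where
  field
    adj    : Fin n → Fin n → Bool
    sym    : ∀ u v → adj u v ≡ adj v u
    irrefl : ∀ v → adj v v ≡ false
open Graph public

N : ∀ {n} → Graph n → Fin n → Subset n
N G v = tabulate (λ w → adj G v w)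

step : ∀ {n} → ℕ → Graph n → Subset n → Subset n
step r G A = A ∪ tabulate (λ v → r ≤ᵇ ∣ N G v ∩ A ∣)

infected : ∀ {n} → ℕ → Graph n → Subset n → ℕ → Subset n
infected r G A zero    = A
infected r G A (suc t) = step r G (infected r G A t)

Percolates : ∀ {n} → ℕ → Graph n → Subset n → Set
Percolates r G A = ∃[ t ] infected r G A t ≡ ⊤

BG : ∀ {n} → ℕ → Graph n → Set
BG r G = ∃[ A ] (∣ A ∣ ≡ r × Percolates r G A)

data Reach {n} (G : Graph n) (X : Subset n) : Fin n → Fin n → Set where
  here : ∀ {u} → u ∉ X → Reach G X u u
  next : ∀ {u w v} → u ∉ X → adj G u w ≡ true → Reach G X w v → Reach G X u v

Disconnected : ∀ {n} → Graph n → Subset n → Set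
Disconnected G X = ∃[ u ] ∃[ v ] (u ∉ X × v ∉ X × ¬ Reach G X u v)

CutSet : ∀ {n} → Graph n → Subset n → Set
CutSet G X = Disconnected G X

IsComponent : ∀ {n} → Graph n → Subset n → Subset n → Set
IsComponent G X C = ∃[ u ] (u ∉ X × (∀ v → (v ∈ C → Reach G X u v) × (Reach G X u v → v ∈ C)))

NotSubset : ∀ {n} → Subset n → Subset n → Set
NotSubset C A = ∃[ v ] (v ∈ C × v ∉ A)

InK : ∀ {n} → Graph n → Subset n → Subset n → Subset n → Set
InK G X A0 C = IsComponent G X C × NotSubset C A0

floorDiv : (r k : ℕ) → k < r → ℕ
floorDiv r k k<r = _/_ r (r ∸ k) {{>-nonZero (m<n⇒0<n∸m k<r)}}

{-# OPTIONS --safe #-}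
module Submission where

open import Defs
open import Data.Bool using (Bool; true; T)
open import Data.Fin using (Fin)
open import Data.Fin.Subset using (Subset; _∈_; _∉_; _⊆_; _∩_; _∪_; ∣_∣; ⊥; ⋃; inside; outside)
open import Data.Fin.Subset.Properties
  using (_∈?_; ∣⊥∣≡0; x∈p∪q⁻; x∈p∪q⁺; x∈p∩q⁻; x∈p∩q⁺; ∉⊥; ∈⊤; ⊆-antisym; p⊆q⇒∣p∣≤∣q∣; p∩q⊆q)
open import Data.List using (List; []; _∷_; length; map)
open import Data.List.Properties using (length-map)
open import Data.List.Relation.Unary.All as All using (All; []; _∷_)
import Data.List.Relation.Unary.All.Properties as All
open import Data.List.Relation.Unary.AllPairs using (AllPairs; []; _∷_)
import Data.List.Relation.Unary.AllPairs.Properties as AllPairs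
open import Data.List.Relation.Unary.Unique.Propositional using (Unique)
open import Data.Nat using (ℕ; zero; suc; _+_; _*_; _∸_; _≤_; _<_; _/_; z≤n; NonZero; >-nonZero)
open import Data.Nat.Properties
  using ( ≤-trans; ≤-reflexive; _≤?_; <⇒≱; ≰⇒>; ≤ᵇ⇒≤; +-comm; +-suc; +-identityʳ; +-mono-≤; +-monoʳ-≤
        ; +-cancelˡ-≤; m≤m+n; m≤n+m∸n; m≤n+o⇒m∸n≤o; ∸-monoˡ-≤; m<n⇒0<n∸m; module ≤-Reasoning)
open import Data.Nat.DivMod using (m*n/n≡m; /-monoˡ-≤)
open import Data.Product using (_×_; _,_; proj₁; proj₂)
open import Data.Sum using (_⊎_; inj₁; inj₂)
open import Data.Unit using (tt)
open import Data.Vec using ([]; _∷_; tabulate)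
open import Data.Vec.Properties using ([]=⇒lookup; lookup∘tabulate)
open import Function using (_on_)
open import Relation.Nullary using (yes; no; contradiction)
open import Relation.Binary.PropositionalEquality using (_≡_; _≢_; refl; trans; cong; subst)
  renaming (sym to ≡-sym)

-- Every neighbour of a vertex in a component C of G − X lies in X or in C.  Hence a vertex
-- of C only ever sees infected neighbours in X ∪ (C ∩ A₀), and if |X| + |C ∩ A₀| < r no
-- vertex of C outside A₀ is ever infected.  So a component not contained in A₀ contains at
-- least r − |X| vertices of A₀, and since components are disjoint, |K| (r − |X|) ≤ |A₀| = r;
-- this gives |K| ≤ ⌊r / (r − |X|)⌋, and for |K| ≥ 2 also r ≤ 2 |X|.

Disjoint : ∀ {n} → Subset n → Subset n → Set
Disjoint p q = ∀ {x} → x ∈ p → x ∉ q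

∣p∪q∣+∣p∩q∣≡∣p∣+∣q∣ : ∀ {n} (p q : Subset n) → ∣ p ∪ q ∣ + ∣ p ∩ q ∣ ≡ ∣ p ∣ + ∣ q ∣
∣p∪q∣+∣p∩q∣≡∣p∣+∣q∣ [] [] = refl
∣p∪q∣+∣p∩q∣≡∣p∣+∣q∣ (inside ∷ p) (inside ∷ q) =
  cong suc (trans (+-suc _ _) (trans (cong suc (∣p∪q∣+∣p∩q∣≡∣p∣+∣q∣ p q)) (≡-sym (+-suc _ _))))
∣p∪q∣+∣p∩q∣≡∣p∣+∣q∣ (inside ∷ p) (outside ∷ q) = cong suc (∣p∪q∣+∣p∩q∣≡∣p∣+∣q∣ p q)
∣p∪q∣+∣p∩q∣≡∣p∣+∣q∣ (outside ∷ p) (inside ∷ q) =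
  trans (cong suc (∣p∪q∣+∣p∩q∣≡∣p∣+∣q∣ p q)) (≡-sym (+-suc _ _))
∣p∪q∣+∣p∩q∣≡∣p∣+∣q∣ (outside ∷ p) (outside ∷ q) = ∣p∪q∣+∣p∩q∣≡∣p∣+∣q∣ p q

∣p∪q∣≤∣p∣+∣q∣ : ∀ {n} (p q : Subset n) → ∣ p ∪ q ∣ ≤ ∣ p ∣ + ∣ q ∣
∣p∪q∣≤∣p∣+∣q∣ p q = ≤-trans (m≤m+n _ _) (≤-reflexive (∣p∪q∣+∣p∩q∣≡∣p∣+∣q∣ p q))

Disjoint⇒∣p∣+∣q∣≤∣p∪q∣ : ∀ {n} (p q : Subset n) → Disjoint p q → ∣ p ∣ + ∣ q ∣ ≤ ∣ p ∪ q ∣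
Disjoint⇒∣p∣+∣q∣≤∣p∪q∣ {n} p q p#q = begin
  ∣ p ∣ + ∣ q ∣          ≡⟨ ∣p∪q∣+∣p∩q∣≡∣p∣+∣q∣ p q ⟨
  ∣ p ∪ q ∣ + ∣ p ∩ q ∣  ≤⟨ +-monoʳ-≤ ∣ p ∪ q ∣ ∣p∩q∣≤0 ⟩
  ∣ p ∪ q ∣ + 0          ≡⟨ +-identityʳ _ ⟩
  ∣ p ∪ q ∣              ∎
  where
  open ≤-Reasoning
  p∩q⊆⊥ : p ∩ q ⊆ ⊥
  p∩q⊆⊥ x∈p∩q = let x∈p , x∈q = x∈p∩q⁻ p q x∈p∩q in contradiction x∈q (p#q x∈p)
  ∣p∩q∣≤0 : ∣ p ∩ q ∣ ≤ 0
  ∣p∩q∣≤0 = ≤-trans (p⊆q⇒∣p∣≤∣q∣ p∩q⊆⊥) (≤-reflexive (∣⊥∣≡0 n))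

Disjoint-∩ʳ : ∀ {n} {p q : Subset n} (a : Subset n) → Disjoint p q → Disjoint (p ∩ a) (q ∩ a)
Disjoint-∩ʳ {p = p} {q} a p#q x∈p∩a x∈q∩a = p#q (proj₁ (x∈p∩q⁻ p a x∈p∩a)) (proj₁ (x∈p∩q⁻ q a x∈q∩a))

Disjoint-⋃ : ∀ {n} {p : Subset n} {qs : List (Subset n)} → All (Disjoint p) qs → Disjoint p (⋃ qs)
Disjoint-⋃ []                        x∈p x∈⊥    = ∉⊥ x∈⊥
Disjoint-⋃ {qs = q ∷ qs} (p#q ∷ p#qs) x∈p x∈q∪qs with x∈p∪q⁻ q (⋃ qs) x∈q∪qs
... | inj₁ x∈q  = p#q x∈p x∈q
... | inj₂ x∈qs = Disjoint-⋃ p#qs x∈p x∈qs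

⋃⊆ : ∀ {n} {p : Subset n} {qs : List (Subset n)} → All (_⊆ p) qs → ⋃ qs ⊆ p
⋃⊆ []                          x∈⊥    = contradiction x∈⊥ ∉⊥
⋃⊆ {qs = q ∷ qs} (q⊆p ∷ qs⊆p) x∈q∪qs with x∈p∪q⁻ q (⋃ qs) x∈q∪qs
... | inj₁ x∈q  = q⊆p x∈q
... | inj₂ x∈qs = ⋃⊆ qs⊆p x∈qs

length*≤∣⋃∣ : ∀ {n} {d} (ps : List (Subset n)) → AllPairs Disjoint ps → All (λ p → d ≤ ∣ p ∣) ps →
              length ps * d ≤ ∣ ⋃ ps ∣
length*≤∣⋃∣ []       _            _            = z≤n
length*≤∣⋃∣ (p ∷ ps) (p#ps ∷ ps#) (d≤p ∷ d≤ps) =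
  ≤-trans (+-mono-≤ d≤p (length*≤∣⋃∣ ps ps# d≤ps))
          (Disjoint⇒∣p∣+∣q∣≤∣p∪q∣ p (⋃ ps) (Disjoint-⋃ p#ps))

m*n≤o⇒m≤o/n : ∀ m n {o} .{{_ : NonZero n}} → m * n ≤ o → m ≤ o / n
m*n≤o⇒m≤o/n m n m*n≤o = ≤-trans (≤-reflexive (≡-sym (m*n/n≡m m n))) (/-monoˡ-≤ n m*n≤o)

2*[m∸n]≤m⇒m≤2*n : ∀ m n → 2 * (m ∸ n) ≤ m → m ≤ 2 * n
2*[m∸n]≤m⇒m≤2*n m n 2[m∸n]≤m = begin
  m                 ≤⟨ m≤n+m∸n m n ⟩
  n + (m ∸ n)       ≤⟨ +-monoʳ-≤ n m∸n≤n ⟩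
  n + n             ≡⟨ cong (n +_) (+-identityʳ n) ⟨
  2 * n             ∎
  where
  open ≤-Reasoning
  m∸n≤n : m ∸ n ≤ n
  m∸n≤n = +-cancelˡ-≤ (m ∸ n) _ _ (begin
    (m ∸ n) + (m ∸ n)  ≡⟨ cong ((m ∸ n) +_) (+-identityʳ (m ∸ n)) ⟨
    2 * (m ∸ n)        ≤⟨ 2[m∸n]≤m ⟩
    m                  ≤⟨ m≤n+m∸n m n ⟩
    n + (m ∸ n)        ≡⟨ +-comm n (m ∸ n) ⟩
    (m ∸ n) + n        ∎)

∈tabulate⁻ : ∀ {n} {f : Fin n → Bool} {x} → x ∈ tabulate f → f x ≡ true
∈tabulate⁻ {f = f} {x} x∈f = trans (≡-sym (lookup∘tabulate f x)) ([]=⇒lookup x∈f)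

∈step⁻ : ∀ {n} (r : ℕ) (G : Graph n) {A : Subset n} {w} →
         w ∈ step r G A → w ∈ A ⊎ r ≤ ∣ N G w ∩ A ∣
∈step⁻ r G {A} w∈A′ with x∈p∪q⁻ A _ w∈A′
... | inj₁ w∈A   = inj₁ w∈A
... | inj₂ w∈new = inj₂ (≤ᵇ⇒≤ r _ (subst T (≡-sym (∈tabulate⁻ w∈new)) tt))

SeparatedBy : ∀ {n} → Graph n → Subset n → Subset n → Set
SeparatedBy G X C = ∀ {w} → w ∈ C → N G w ⊆ X ∪ C

module _ {n} (r : ℕ) (G : Graph n) {X C A : Subset n} (C-sep : SeparatedBy G X C) where

  separated⇒infected∩C⊆A : ∣ X ∣ + ∣ C ∩ A ∣ < r → ∀ t {w} → w ∈ C → w ∈ infected r G A t → w ∈ A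
  separated⇒infected∩C⊆A _   zero    _   w∈A    = w∈A
  separated⇒infected∩C⊆A few (suc t) {w} w∈C w∈Aₜ₊₁ with ∈step⁻ r G w∈Aₜ₊₁
  ... | inj₁ w∈Aₜ = separated⇒infected∩C⊆A few t w∈C w∈Aₜ
  ... | inj₂ r≤∣N∩Aₜ∣ = contradiction r≤∣X∣+∣C∩A∣ (<⇒≱ few)
    where
    N∩Aₜ⊆X∪C∩A : N G w ∩ infected r G A t ⊆ X ∪ (C ∩ A)
    N∩Aₜ⊆X∪C∩A z∈ with x∈p∩q⁻ (N G w) _ z∈
    ... | z∈N , z∈Aₜ with x∈p∪q⁻ X C (C-sep w∈C z∈N)
    ...   | inj₁ z∈X = x∈p∪q⁺ (inj₁ z∈X)
    ...   | inj₂ z∈C = x∈p∪q⁺ (inj₂ (x∈p∩q⁺ (z∈C , separated⇒infected∩C⊆A few t z∈C z∈Aₜ)))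
    r≤∣X∣+∣C∩A∣ : r ≤ ∣ X ∣ + ∣ C ∩ A ∣
    r≤∣X∣+∣C∩A∣ = ≤-trans r≤∣N∩Aₜ∣ (≤-trans (p⊆q⇒∣p∣≤∣q∣ N∩Aₜ⊆X∪C∩A) (∣p∪q∣≤∣p∣+∣q∣ X (C ∩ A)))

  percolates⇒r≤∣X∣+∣C∩A∣ : Percolates r G A → NotSubset C A → r ≤ ∣ X ∣ + ∣ C ∩ A ∣
  percolates⇒r≤∣X∣+∣C∩A∣ (t , Aₜ≡⊤) (v , v∈C , v∉A) with r ≤? ∣ X ∣ + ∣ C ∩ A ∣
  ... | yes r≤ = r≤
  ... | no  r≰ = contradiction (separated⇒infected∩C⊆A (≰⇒> r≰) t v∈C v∈Aₜ) v∉A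
    where
    v∈Aₜ : v ∈ infected r G A t
    v∈Aₜ = subst (v ∈_) (≡-sym Aₜ≡⊤) ∈⊤

module _ {n} (G : Graph n) (X : Subset n) where

  Reach-snoc : ∀ {u v w} → Reach G X u v → adj G v w ≡ true → w ∉ X → Reach G X u w
  Reach-snoc (here u∉X)                v~w w∉X = next u∉X v~w (here w∉X)
  Reach-snoc (next u∉X u~u′ u′⇝v) v~w w∉X = next u∉X u~u′ (Reach-snoc u′⇝v v~w w∉X)

  Reach-trans : ∀ {u v w} → Reach G X u v → Reach G X v w → Reach G X u w
  Reach-trans (here _)                 v⇝w = v⇝w
  Reach-trans (next u∉X u~u′ u′⇝v) v⇝w = next u∉X u~u′ (Reach-trans u′⇝v v⇝w)

  Reach-sym : ∀ {u v} → Reach G X u v → Reach G X v u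
  Reach-sym (here u∉X) = here u∉X
  Reach-sym {u} (next {w = u′} u∉X u~u′ u′⇝v) =
    Reach-snoc (Reach-sym u′⇝v) (trans (sym G u′ u) u~u′) u∉X

  component-separated : ∀ {C} → IsComponent G X C → SeparatedBy G X C
  component-separated (u , _ , C-spec) {w} w∈C {z} z∈N with z ∈? X
  ... | yes z∈X = x∈p∪q⁺ (inj₁ z∈X)
  ... | no  z∉X = x∈p∪q⁺ (inj₂ (proj₂ (C-spec z) u⇝z))
    where
    u⇝z : Reach G X u z
    u⇝z = Reach-snoc (proj₁ (C-spec w) w∈C) (∈tabulate⁻ z∈N) z∉X

  components-disjoint : ∀ {C D} → IsComponent G X C → IsComponent G X D → C ≢ D → Disjoint C D
  components-disjoint {C} {D} (u , _ , C-spec) (v , _ , D-spec) C≢D {x} x∈C x∈D =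
    C≢D (⊆-antisym (λ {y} y∈C → proj₂ (D-spec y) (Reach-trans v⇝u (proj₁ (C-spec y) y∈C)))
                   (λ {y} y∈D → proj₂ (C-spec y) (Reach-trans u⇝v (proj₁ (D-spec y) y∈D))))
    where
    u⇝v : Reach G X u v
    u⇝v = Reach-trans (proj₁ (C-spec x) x∈C) (Reach-sym (proj₁ (D-spec x) x∈D))
    v⇝u : Reach G X v u
    v⇝u = Reach-sym u⇝v

module _ {n} (G : Graph n) (X A : Subset n) where

  InK-pairwise-disjoint : ∀ {Ks} → Unique Ks → All (InK G X A) Ks → AllPairs (Disjoint on (_∩ A)) Ks
  InK-pairwise-disjoint         []               []           = []
  InK-pairwise-disjoint {C ∷ _} (C≢Ks ∷ Ks-uniq) (C∈K ∷ Ks∈K) =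
    All.zipWith C∩A#D∩A (C≢Ks , Ks∈K) ∷ InK-pairwise-disjoint Ks-uniq Ks∈K
    where
    C∩A#D∩A : ∀ {D} → C ≢ D × InK G X A D → Disjoint (C ∩ A) (D ∩ A)
    C∩A#D∩A (C≢D , D∈K) = Disjoint-∩ʳ A (components-disjoint G X (proj₁ C∈K) (proj₁ D∈K) C≢D)

  length*≤∣A∣ : ∀ d → (∀ {C} → InK G X A C → d ≤ ∣ C ∩ A ∣) →
                ∀ {Ks} → Unique Ks → All (InK G X A) Ks → length Ks * d ≤ ∣ A ∣
  length*≤∣A∣ d d≤∣C∩A∣ {Ks} Ks-uniq Ks∈K = begin
    length Ks * d               ≡⟨ cong (_* d) (length-map (_∩ A) Ks) ⟨
    length (map (_∩ A) Ks) * d  ≤⟨ length*≤∣⋃∣ (map (_∩ A) Ks)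
                                     (AllPairs.map⁺ (InK-pairwise-disjoint Ks-uniq Ks∈K))
                                     (All.map⁺ (All.map d≤∣C∩A∣ Ks∈K)) ⟩
    ∣ ⋃ (map (_∩ A) Ks) ∣       ≤⟨ p⊆q⇒∣p∣≤∣q∣ (⋃⊆ {qs = map (_∩ A) Ks} (All.map⁺ Ks∩A⊆A)) ⟩
    ∣ A ∣                       ∎
    where
    open ≤-Reasoning
    Ks∩A⊆A : All (λ C → C ∩ A ⊆ A) Ks
    Ks∩A⊆A = All.tabulate λ {C} _ → p∩q⊆q C A

InK⇒r∸∣X∣≤∣C∩A∣ : ∀ {n} (r : ℕ) (G : Graph n) {X A C : Subset n} →
                   Percolates r G A → InK G X A C → r ∸ ∣ X ∣ ≤ ∣ C ∩ A ∣
InK⇒r∸∣X∣≤∣C∩A∣ r G {X} perc (C-comp , C⊈A) =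
  m≤n+o⇒m∸n≤o r ∣ X ∣ (percolates⇒r≤∣X∣+∣C∩A∣ r G (component-separated G X C-comp) perc C⊈A)

mainTheorem3 : (r n : ℕ) → 1 ≤ r → (G : Graph n) → BG r G → suc r ≤ n →
    (A0 : Subset n) → Percolates r G A0 → ∣ A0 ∣ ≡ r →
    (X : Subset n) → CutSet G X → (hX : ∣ X ∣ < r) →
    ((C : Subset n) → InK G X A0 C → r ∸ ∣ X ∣ ≤ ∣ C ∩ A0 ∣)
    × ((Ks : List (Subset n)) → Unique Ks → All (InK G X A0) Ks →
        length Ks ≤ floorDiv r ∣ X ∣ hX)
    × ((C₁ C₂ : Subset n) → C₁ ≢ C₂ → InK G X A0 C₁ → InK G X A0 C₂ →
        r ≤ 2 * ∣ X ∣ × ∣ X ∣ ≤ r ∸ 1)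
mainTheorem3 r n _ G _ _ A0 perc ∣A0∣≡r X _ hX =
  (λ _ → InK⇒r∸∣X∣≤∣C∩A∣ r G perc) ,
  (λ Ks Ks-uniq Ks∈K →
    m*n≤o⇒m≤o/n (length Ks) (r ∸ ∣ X ∣) {{>-nonZero (m<n⇒0<n∸m hX)}} (length*≤r Ks-uniq Ks∈K)) ,
  (λ C₁ C₂ C₁≢C₂ C₁∈K C₂∈K →
    2*[m∸n]≤m⇒m≤2*n r ∣ X ∣ (length*≤r ((C₁≢C₂ ∷ []) ∷ [] ∷ []) (C₁∈K ∷ C₂∈K ∷ [])) ,
    ∸-monoˡ-≤ 1 hX)
  where
  length*≤r : ∀ {Ks} → Unique Ks → All (InK G X A0) Ks → length Ks * (r ∸ ∣ X ∣) ≤ r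
  length*≤r Ks-uniq Ks∈K =
    ≤-trans (length*≤∣A∣ G X A0 (r ∸ ∣ X ∣) (InK⇒r∸∣X∣≤∣C∩A∣ r G perc) Ks-uniq Ks∈K) (≤-reflexive ∣A0∣≡r)
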